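{- For all $\varphi,\psi\in\mathcal{L}$, if $\top\vdash_\mathsf{F}\varphi\vee\psi$, then $\top\vdash_\mathsf{F}\varphi$ or $\top\vdash_\mathsf{F}\psi$.
   Context: $\mathcal{L}$ is given by $\varphi::= p\mid\neg\varphi\mid(\varphi\wedge\varphi)\mid(\varphi\vee\varphi)$, $p$ in a nonempty set $\mathsf{Prop}$; fix $p_0\in\mathsf{Prop}$ and set $\bot:=(p_0\wedge\neg p_0)$, $\top:=\neg\bot$. $\vdash_\mathsf{F}$ is defined by Fitch-style proofs: finite sequences whose first entry is a formula and whose later entries are formulas or proofs; the set of proofs is the smallest set containing $\langle\varphi\rangle$ for each formula and closed under, for a proof $\langle\sigma_1,\dots,\sigma_n\rangle$ and $1\le i,j\le n$: appending any proof $\tau$; ($\wedge$I) appending $\sigma_i\wedge\sigma_j$ for formulas $\sigma_i,\sigma_j$; ($\wedge$E) if $\sigma_i=\varphi\wedge\psi$, appending $\varphi$ or $\psi$; ($\vee$I) if $\sigma_i$ is a formula, appending $\sigma_i\vee\varphi$ or $\varphi\vee\sigma_i$ for any $\varphi$; ($\vee$E) if $\sigma_i=\varphi\vee\psi$, $\sigma_{n-1}$ is a sequence beginning with $\varphi$ and ending with $\chi$, and $\sigma_n$ is a sequence beginning with $\psi$ and ending with $\chi$, appending $\chi$; ($\neg$I) if $\sigma_i$ is a formula $\psi$ and $\sigma_n$ is a sequence beginning with $\varphi$ and ending with $\neg\psi$, appending $\neg\varphi$; ($\neg$E) if $\sigma_i=\varphi$ and $\sigma_j=\neg\varphi$, appending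 any formula $\psi$. $\varphi\vdash_\mathsf{F}\psi$ iff some proof has first entry $\varphi$ and last entry $\psi$. -}

module Defs where

open import Data.List using (List; []; _∷_; _∷ʳ_; _++_)
open import Data.List.Membership.Propositional using (_∈_)
open import Data.Product using (Σ; ∃; _×_; _,_)
open import Relation.Binary.PropositionalEquality using (_≡_)

data Formula (P : Set) : Set where
  var  : P → Formula P
  ¬'_  : Formula P → Formula P
  _∧'_ : Formula P → Formula P → Formula P
  _∨'_ : Formula P → Formula P → Formula P

Bot : {P : Set} → P → Formula P
Bot p0 = var p0 ∧' (¬' var p0)

Top : {P : Set} → P → Formula P
Top p0 = ¬' Bot p0

data Entry (P : Set) : Set where
  fm  : Formula P → Entry P
  sub : List (Entry P) → Entry P

BeginsWith : {P : Set} → List (Entry P) → Formula P → Set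
BeginsWith {P} s φ = Σ (List (Entry P)) λ rest → s ≡ fm φ ∷ rest

EndsWith : {P : Set} → List (Entry P) → Formula P → Set
EndsWith {P} s χ = Σ (List (Entry P)) λ ini → s ≡ ini ∷ʳ fm χ

-- The set of Fitch proofs (smallest set closed under the rules).
-- "σ_i for some 1 ≤ i ≤ n" is rendered as membership in the sequence.
data IsProof {P : Set} : List (Entry P) → Set where
  start : (φ : Formula P) → IsProof (fm φ ∷ [])
  subp  : ∀ {σ τ} → IsProof σ → IsProof τ → IsProof (σ ∷ʳ sub τ)
  ∧I    : ∀ {σ φ ψ} → IsProof σ → fm φ ∈ σ → fm ψ ∈ σ → IsProof (σ ∷ʳ fm (φ ∧' ψ))
  ∧E₁   : ∀ {σ φ ψ} → IsProof σ → fm (φ ∧' ψ) ∈ σ → IsProof (σ ∷ʳ fm φ)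
  ∧E₂   : ∀ {σ φ ψ} → IsProof σ → fm (φ ∧' ψ) ∈ σ → IsProof (σ ∷ʳ fm ψ)
  ∨I₁   : ∀ {σ φ} (ψ : Formula P) → IsProof σ → fm φ ∈ σ → IsProof (σ ∷ʳ fm (φ ∨' ψ))
  ∨I₂   : ∀ {σ φ} (ψ : Formula P) → IsProof σ → fm φ ∈ σ → IsProof (σ ∷ʳ fm (ψ ∨' φ))
  ∨E    : ∀ {ρ s₁ s₂ φ ψ χ} → IsProof (ρ ++ sub s₁ ∷ sub s₂ ∷ []) →
          fm (φ ∨' ψ) ∈ (ρ ++ sub s₁ ∷ sub s₂ ∷ []) →
          BeginsWith s₁ φ → EndsWith s₁ χ →
          BeginsWith s₂ ψ → EndsWith s₂ χ →
          IsProof ((ρ ++ sub s₁ ∷ sub s₂ ∷ []) ∷ʳ fm χ)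
  ¬I    : ∀ {ρ s φ ψ} → IsProof (ρ ∷ʳ sub s) → fm ψ ∈ (ρ ∷ʳ sub s) →
          BeginsWith s φ → EndsWith s (¬' ψ) →
          IsProof ((ρ ∷ʳ sub s) ∷ʳ fm (¬' φ))
  ¬E    : ∀ {σ φ} (ψ : Formula P) → IsProof σ → fm φ ∈ σ → fm (¬' φ) ∈ σ →
          IsProof (σ ∷ʳ fm ψ)

_⊢F_ : {P : Set} → Formula P → Formula P → Set
_⊢F_ {P} φ ψ = Σ (List (Entry P)) λ σ → IsProof σ × BeginsWith σ φ × EndsWith σ ψ

{-# OPTIONS --safe #-}
module Submission where

-- No rule eliminates double negation, so the calculus is intuitionistic and
-- Aczel's slash applies.  Call φ slashed when ⊤ ⊢F φ and, recursively, both
-- conjuncts of a conjunction, some disjunct of a disjunction, and no argument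
-- of a negation are slashed.  Every rule carries slashed premises to a slashed
-- conclusion (for ¬I because a slashed hypothesis would make both ψ and ¬ψ
-- slashed), so every consequence of the slashed formula ⊤ is slashed.
-- Derivability of the conclusions comes from cut, which the calculus admits
-- via ∨E on ψ ∨ ψ.

open import Defs
open import Data.Sum as Sum using (_⊎_; inj₁; inj₂; [_,_]′)
open import Data.Product using (_×_; _,_; proj₁; proj₂; ∃)
open import Data.List using (List; []; _∷_; _∷ʳ_; _++_)
open import Data.List.Properties using (++-assoc)
open import Data.List.Membership.Propositional using (_∈_)
open import Data.List.Membership.Propositional.Properties using (∈-++⁺ˡ; ∈-++⁺ʳ; ∈-++⁻; ∈-insert)
open import Data.List.Relation.Unary.Any using (here; there)
open import Data.Unit using (⊤)
open import Data.Empty using (⊥-elim)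
open import Relation.Nullary using (¬_)
open import Relation.Binary.PropositionalEquality using (_≡_; refl; subst)

∈-∷ʳ : {A : Set} (xs : List A) (x : A) → x ∈ xs ∷ʳ x
∈-∷ʳ xs x = ∈-insert xs

∈-∷ʳ⁻ : {A : Set} {xs : List A} {x y : A} → y ∈ xs ∷ʳ x → y ∈ xs ⊎ y ≡ x
∈-∷ʳ⁻ {xs = xs} m with ∈-++⁻ xs m
... | inj₁ m′ = inj₁ m′
... | inj₂ (here eq) = inj₂ eq

module _ {P : Set} where

  BeginsWith-++ : {σ : List (Entry P)} {φ : Formula P} (xs : List (Entry P)) →
                  BeginsWith σ φ → BeginsWith (σ ++ xs) φ
  BeginsWith-++ xs (rest , refl) = rest ++ xs , refl

  BeginsWith-∷ʳ⁻ : {σ : List (Entry P)} {x : Entry P} {φ ψ : Formula P} →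
                   BeginsWith σ ψ → BeginsWith (σ ∷ʳ x) φ → BeginsWith σ φ
  BeginsWith-∷ʳ⁻ (rest , refl) (_ , refl) = rest , refl

  EndsWith⇒∈ : {σ : List (Entry P)} {φ : Formula P} → EndsWith σ φ → fm φ ∈ σ
  EndsWith⇒∈ (ini , refl) = ∈-∷ʳ ini _

  IsProof⇒BeginsWith : {σ : List (Entry P)} → IsProof σ → ∃ (BeginsWith σ)
  IsProof⇒BeginsWith (start φ)          = φ , [] , refl
  IsProof⇒BeginsWith (subp p _)         = _ , BeginsWith-++ _ (proj₂ (IsProof⇒BeginsWith p))
  IsProof⇒BeginsWith (∧I p _ _)         = _ , BeginsWith-++ _ (proj₂ (IsProof⇒BeginsWith p))
  IsProof⇒BeginsWith (∧E₁ p _)          = _ , BeginsWith-++ _ (proj₂ (IsProof⇒BeginsWith p))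
  IsProof⇒BeginsWith (∧E₂ p _)          = _ , BeginsWith-++ _ (proj₂ (IsProof⇒BeginsWith p))
  IsProof⇒BeginsWith (∨I₁ _ p _)        = _ , BeginsWith-++ _ (proj₂ (IsProof⇒BeginsWith p))
  IsProof⇒BeginsWith (∨I₂ _ p _)        = _ , BeginsWith-++ _ (proj₂ (IsProof⇒BeginsWith p))
  IsProof⇒BeginsWith (∨E p _ _ _ _ _)   = _ , BeginsWith-++ _ (proj₂ (IsProof⇒BeginsWith p))
  IsProof⇒BeginsWith (¬I p _ _ _)       = _ , BeginsWith-++ _ (proj₂ (IsProof⇒BeginsWith p))
  IsProof⇒BeginsWith (¬E _ p _ _)       = _ , BeginsWith-++ _ (proj₂ (IsProof⇒BeginsWith p))

  IsProof-BeginsWith-∷ʳ⁻ : {σ : List (Entry P)} {x : Entry P} {φ : Formula P} →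
                           IsProof σ → BeginsWith (σ ∷ʳ x) φ → BeginsWith σ φ
  IsProof-BeginsWith-∷ʳ⁻ p = BeginsWith-∷ʳ⁻ (proj₂ (IsProof⇒BeginsWith p))

  ⊢F-refl : (φ : Formula P) → φ ⊢F φ
  ⊢F-refl φ = fm φ ∷ [] , start φ , ([] , refl) , ([] , refl)

  ⊢F-trans : {φ ψ χ : Formula P} → φ ⊢F ψ → ψ ⊢F χ → φ ⊢F χ
  ⊢F-trans {ψ = ψ} {χ} (π , p , bπ , eπ) (ρ , q , bρ , eρ) =
    σ ∷ʳ fm χ , ∨E σ-proof ψ∨ψ∈σ bρ eρ bρ eρ ,
    BeginsWith-++ _ (BeginsWith-++ _ (BeginsWith-++ _ bπ)) , σ , refl
    where
      π′ : List (Entry P)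
      π′ = π ∷ʳ fm (ψ ∨' ψ)
      σ : List (Entry P)
      σ = π′ ++ sub ρ ∷ sub ρ ∷ []
      σ-proof : IsProof σ
      σ-proof = subst IsProof (++-assoc π′ _ _) (subp (subp (∨I₁ ψ p (EndsWith⇒∈ eπ)) q) q)
      ψ∨ψ∈σ : fm (ψ ∨' ψ) ∈ σ
      ψ∨ψ∈σ = ∈-++⁺ˡ (∈-∷ʳ π _)

  ∧-elimˡ : (φ ψ : Formula P) → (φ ∧' ψ) ⊢F φ
  ∧-elimˡ φ ψ = _ , ∧E₁ (start (φ ∧' ψ)) (here refl) , (fm φ ∷ [] , refl) , (fm (φ ∧' ψ) ∷ [] , refl)

module Slash {P : Set} (p₀ : P) where

  Slash : Formula P → Set
  Slash* : Formula P → Set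

  Slash (var p)  = ⊤
  Slash (¬' φ)   = ¬ Slash* φ
  Slash (φ ∧' ψ) = Slash φ × Slash ψ
  Slash (φ ∨' ψ) = Slash* φ ⊎ Slash* ψ

  Slash* φ = Slash φ × Top p₀ ⊢F φ

  SlashClosed : List (Entry P) → Set
  SlashClosed σ = ∀ {φ ψ} → BeginsWith σ φ → Slash* φ → fm ψ ∈ σ → Slash* ψ

  HereditarilySlashClosed : List (Entry P) → Set
  HereditarilySlashClosed σ = SlashClosed σ × (∀ {τ} → sub τ ∈ σ → SlashClosed τ)

  HereditarilySlashClosed-∷ʳ-sub : {σ τ : List (Entry P)} → IsProof σ →
    HereditarilySlashClosed σ → SlashClosed τ → HereditarilySlashClosed (σ ∷ʳ sub τ)
  HereditarilySlashClosed-∷ʳ-sub {σ} {τ} p (closed , subClosed) τ-closed = closed′ , subClosed′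
    where
      closed′ : SlashClosed (σ ∷ʳ sub τ)
      closed′ b g m with ∈-∷ʳ⁻ m
      ... | inj₁ m′ = closed (IsProof-BeginsWith-∷ʳ⁻ p b) g m′
      ... | inj₂ ()
      subClosed′ : ∀ {τ′} → sub τ′ ∈ σ ∷ʳ sub τ → SlashClosed τ′
      subClosed′ m with ∈-∷ʳ⁻ m
      ... | inj₁ m′ = subClosed m′
      ... | inj₂ refl = τ-closed

  HereditarilySlashClosed-∷ʳ-fm : {σ : List (Entry P)} {χ : Formula P} → IsProof σ →
    IsProof (σ ∷ʳ fm χ) → HereditarilySlashClosed σ →
    (∀ {φ} → BeginsWith σ φ → Slash* φ → Slash χ) → HereditarilySlashClosed (σ ∷ʳ fm χ)
  HereditarilySlashClosed-∷ʳ-fm {σ} {χ} p p′ (closed , subClosed) slash-χ = closed′ , subClosed′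
    where
      closed′ : SlashClosed (σ ∷ʳ fm χ)
      closed′ b g m with ∈-∷ʳ⁻ m
      ... | inj₁ m′ = closed (IsProof-BeginsWith-∷ʳ⁻ p b) g m′
      ... | inj₂ refl = slash-χ (IsProof-BeginsWith-∷ʳ⁻ p b) g ,
                        ⊢F-trans (proj₂ g) (_ , p′ , b , σ , refl)
      subClosed′ : ∀ {τ} → sub τ ∈ σ ∷ʳ fm χ → SlashClosed τ
      subClosed′ m with ∈-∷ʳ⁻ m
      ... | inj₁ m′ = subClosed m′
      ... | inj₂ ()

  IsProof⇒HereditarilySlashClosed : {σ : List (Entry P)} → IsProof σ → HereditarilySlashClosed σ
  IsProof⇒HereditarilySlashClosed (start φ) = closed , λ { (here ()) ; (there ()) }
    where
      closed : SlashClosed (fm φ ∷ [])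
      closed (_ , refl) g (here refl) = g
  IsProof⇒HereditarilySlashClosed (subp p q) =
    HereditarilySlashClosed-∷ʳ-sub p (IsProof⇒HereditarilySlashClosed p)
                                     (proj₁ (IsProof⇒HereditarilySlashClosed q))
  IsProof⇒HereditarilySlashClosed p′@(∧I p m₁ m₂) =
    HereditarilySlashClosed-∷ʳ-fm p p′ H λ b g → proj₁ (proj₁ H b g m₁) , proj₁ (proj₁ H b g m₂)
    where H = IsProof⇒HereditarilySlashClosed p
  IsProof⇒HereditarilySlashClosed p′@(∧E₁ p m) =
    HereditarilySlashClosed-∷ʳ-fm p p′ H λ b g → proj₁ (proj₁ (proj₁ H b g m))
    where H = IsProof⇒HereditarilySlashClosed p
  IsProof⇒HereditarilySlashClosed p′@(∧E₂ p m) =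
    HereditarilySlashClosed-∷ʳ-fm p p′ H λ b g → proj₂ (proj₁ (proj₁ H b g m))
    where H = IsProof⇒HereditarilySlashClosed p
  IsProof⇒HereditarilySlashClosed p′@(∨I₁ _ p m) =
    HereditarilySlashClosed-∷ʳ-fm p p′ H λ b g → inj₁ (proj₁ H b g m)
    where H = IsProof⇒HereditarilySlashClosed p
  IsProof⇒HereditarilySlashClosed p′@(∨I₂ _ p m) =
    HereditarilySlashClosed-∷ʳ-fm p p′ H λ b g → inj₂ (proj₁ H b g m)
    where H = IsProof⇒HereditarilySlashClosed p
  IsProof⇒HereditarilySlashClosed p′@(∨E {ρ} {s₁} {s₂} p m b₁ e₁ b₂ e₂) =
    HereditarilySlashClosed-∷ʳ-fm p p′ H λ b g →
      [ branch (∈-++⁺ʳ ρ (here refl)) b₁ e₁ , branch (∈-++⁺ʳ ρ (there (here refl))) b₂ e₂ ]′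
        (proj₁ (proj₁ H b g m))
    where
      H = IsProof⇒HereditarilySlashClosed p
      branch : ∀ {s φ χ} → sub s ∈ ρ ++ sub s₁ ∷ sub s₂ ∷ [] → BeginsWith s φ → EndsWith s χ → Slash* φ → Slash χ
      branch n b e g = proj₁ (proj₂ H n b g (EndsWith⇒∈ e))
  IsProof⇒HereditarilySlashClosed p′@(¬I {ρ} p m b₁ e₁) =
    HereditarilySlashClosed-∷ʳ-fm p p′ H λ b g g-φ →
      proj₁ (proj₂ H (∈-∷ʳ ρ _) b₁ g-φ (EndsWith⇒∈ e₁)) (proj₁ H b g m)
    where H = IsProof⇒HereditarilySlashClosed p
  IsProof⇒HereditarilySlashClosed p′@(¬E _ p m m¬) =
    HereditarilySlashClosed-∷ʳ-fm p p′ H λ b g → ⊥-elim (proj₁ (proj₁ H b g m¬) (proj₁ H b g m))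
    where H = IsProof⇒HereditarilySlashClosed p

  ⊢F-Slash* : {φ ψ : Formula P} → φ ⊢F ψ → Slash* φ → Slash* ψ
  ⊢F-Slash* (_ , p , b , e) g = proj₁ (IsProof⇒HereditarilySlashClosed p) b g (EndsWith⇒∈ e)

  Slash*-Top : Slash* (Top p₀)
  Slash*-Top = ¬Slash*-Bot , ⊢F-refl (Top p₀)
    where
      ¬Slash*-Bot : ¬ Slash* (Bot p₀)
      ¬Slash*-Bot ((_ , ¬Slash*-p₀) , ⊢Bot) = ¬Slash*-p₀ (_ , ⊢F-trans ⊢Bot (∧-elimˡ _ _))

proposition4p28 : {P : Set} (p₀ : P) (φ ψ : Formula P) → Top p₀ ⊢F (φ ∨' ψ) → (Top p₀ ⊢F φ) ⊎ (Top p₀ ⊢F ψ)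
proposition4p28 p₀ φ ψ ⊢φ∨ψ = Sum.map proj₂ proj₂ (proj₁ (⊢F-Slash* ⊢φ∨ψ Slash*-Top))
  where open Slash p₀
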